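{- For a network $N$, its completion $\mathcal{C}(N)$ is a network and is phylogenetically compatible with $N$.
   Context: A semidirected graph is $N=(V,E)$ with $E=E_U\sqcup E_D$, $E_U$ undirected edges $uv$, $E_D$ directed edges $(u,v)$ ($u$ parent, $v$ child); parallel directed edges allowed, no self-loops. $\deg_i(v,N)$ is the number of directed edges with child $v$. $N'$ is compatible with $N$ if obtained by directing some undirected edges. A semidirected cycle is a semidirected graph whose undirected edges can be directed to make it a directed cycle; acyclic (SDAG) means containing no semidirected cycle; DAG = acyclic directed graph. Tree node: $\deg_i\le1$; hybrid node otherwise. Hybrid edge: directed edge with hybrid child; $E_H(N)$ their set. SDAG $N'$ is phylogenetically compatible with SDAG $N$ if compatible and $E_H(N')=E_H(N)$; a rooted partner of $N$ is a DAG phylogenetically compatible with $N$; a network is an SDAG admitting a rooted partner. A semidirected path from $u_0$ to $u_n$ is $u_0\dots u_n$ with $u_{i-1}u_i$ or $(u_{i-1},u_i)$ an edge for each $i$; $v\lesssim u$ if there is a semidirected path from $u$ to $v$; $u\sim v$ if $u\lesssim v$ and $v\lesssim u$. An undirected component is the subgraph induced by a $\sim$-class; a root component is one whose class is maximal under $\lesssim$. $E_{DP}(N)$ is the set of edges not in any root component; every edge of $E_{DP}(N)$ has the same direction in all rooted partners of $N$. The completion $\mathcal{C}(N)$ is the semidirected graph obtained from $N$ by directing every undirected edge $uv\in E_{DP}(N)$ as $(u,v)$ if $(u,v)$ is an edge of some (equivalently every) rooted partner of $N$. -}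

module Defs where

open import Data.Nat using (ℕ; zero; suc; _≤_)
open import Data.Fin using (Fin; zero; suc; fromℕ; inject₁; _≟_)
open import Data.List using (List; length; filterᵇ; allFin)
open import Data.Bool using (Bool; true; false)
open import Data.Product using (Σ; ∃; ∃-syntax; _×_; _,_)
open import Data.Sum using (_⊎_)
open import Relation.Nullary using (¬_; does)
open import Relation.Binary.PropositionalEquality using (_≡_; _≢_)
open import Function.Definitions using (Injective)
open import Function.Bundles using (_⇔_)

-- An edge on vertex set Fin n: undirected uv, or directed (u,v) with parent u, child v.
data Edge (n : ℕ) : Set where
  undir : Fin n → Fin n → Edge n
  dir   : Fin n → Fin n → Edge n

NoLoop : ∀ {n} → Edge n → Set
NoLoop (undir u v) = u ≢ v
NoLoop (dir u v)   = u ≢ v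

-- A (finite) semidirected graph with vertices Fin n and m edges labelled by Fin m
-- (edge labels allow parallel edges); no self-loops.
record SDGraph (n m : ℕ) : Set where
  field
    edge   : Fin m → Edge n
    noLoop : ∀ i → NoLoop (edge i)
open SDGraph public

Link : ∀ {n m} → SDGraph n m → Fin m → Fin n → Fin n → Set
Link N i u w = (edge N i ≡ undir u w) ⊎ (edge N i ≡ undir w u) ⊎ (edge N i ≡ dir u w)

EdgeCompatible : ∀ {n} → Edge n → Edge n → Set
EdgeCompatible e' e = (e' ≡ e) ⊎ (∃[ u ] ∃[ v ] (e ≡ undir u v × (e' ≡ dir u v ⊎ e' ≡ dir v u)))

Compatible : ∀ {n m} → SDGraph n m → SDGraph n m → Set
Compatible N' N = ∀ i → EdgeCompatible (edge N' i) (edge N i)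

-- N contains a semidirected cycle: distinct vertices v_0..v_k, distinct edges
-- e_0..e_k, with e_j joining v_j to v_{j+1} (indices mod k+1), each undirected
-- or directed forward, so that directing the undirected ones gives a directed cycle.
record SDCycle {n m : ℕ} (N : SDGraph n m) : Set where
  field
    len    : ℕ
    verts  : Fin (suc (suc len)) → Fin n
    edges  : Fin (suc len) → Fin m
    closed : verts (fromℕ (suc len)) ≡ verts zero
    links  : ∀ j → Link N (edges j) (verts (inject₁ j)) (verts (suc j))
    edgesDistinct : Injective _≡_ _≡_ edges
    vertsDistinct : Injective _≡_ _≡_ (λ j → verts (inject₁ j))

Acyclic : ∀ {n m} → SDGraph n m → Set
Acyclic N = ¬ SDCycle N

AllDirected : ∀ {n m} → SDGraph n m → Set
AllDirected N = ∀ i → ∃[ u ] ∃[ v ] (edge N i ≡ dir u v)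

IsDAG : ∀ {n m} → SDGraph n m → Set
IsDAG N = AllDirected N × Acyclic N

intoᵇ : ∀ {n} → Edge n → Fin n → Bool
intoᵇ (undir _ _) v = false
intoᵇ (dir _ w)   v = does (w ≟ v)

indeg : ∀ {n m} → SDGraph n m → Fin n → ℕ
indeg {m = m} N v = length (filterᵇ (λ i → intoᵇ (edge N i) v) (allFin m))

IsHybrid : ∀ {n m} → SDGraph n m → Fin n → Set
IsHybrid N v = 2 ≤ indeg N v

IsHybridEdge : ∀ {n m} → SDGraph n m → Fin m → Set
IsHybridEdge N i = ∃[ u ] ∃[ v ] (edge N i ≡ dir u v × IsHybrid N v)

PhyloCompatible : ∀ {n m} → SDGraph n m → SDGraph n m → Set
PhyloCompatible N' N =
  Acyclic N' × Acyclic N × Compatible N' N × (∀ i → IsHybridEdge N' i ⇔ IsHybridEdge N i)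

IsRootedPartner : ∀ {n m} → SDGraph n m → SDGraph n m → Set
IsRootedPartner R N = IsDAG R × PhyloCompatible R N

IsNetwork : ∀ {n m} → SDGraph n m → Set
IsNetwork {n} {m} N = Acyclic N × Σ (SDGraph n m) (λ R → IsRootedPartner R N)

data SDPath {n m : ℕ} (N : SDGraph n m) : Fin n → Fin n → Set where
  here : ∀ {u} → SDPath N u u
  step : ∀ {u w v} (i : Fin m) → Link N i u w → SDPath N w v → SDPath N u v

_⊢_≲_ : ∀ {n m} → SDGraph n m → Fin n → Fin n → Set
N ⊢ v ≲ u = SDPath N u v

_⊢_∼_ : ∀ {n m} → SDGraph n m → Fin n → Fin n → Set
N ⊢ u ∼ v = (N ⊢ u ≲ v) × (N ⊢ v ≲ u)

InRootClass : ∀ {n m} → SDGraph n m → Fin n → Set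
InRootClass N u = ∀ w → N ⊢ u ≲ w → N ⊢ w ≲ u

Endpoints : ∀ {n} → Edge n → Fin n → Fin n → Set
Endpoints (undir a b) u v = a ≡ u × b ≡ v
Endpoints (dir a b)   u v = a ≡ u × b ≡ v

InRootComponent : ∀ {n m} → SDGraph n m → Fin m → Set
InRootComponent N i =
  ∃[ u ] ∃[ v ] (Endpoints (edge N i) u v × N ⊢ u ∼ v × InRootClass N u)

InEDP : ∀ {n m} → SDGraph n m → Fin m → Set
InEDP N i = ¬ InRootComponent N i

IsCompletion : ∀ {n m} → SDGraph n m → SDGraph n m → Set
IsCompletion {n} {m} N C = ∀ i →
  ((InEDP N i × (∃[ u ] ∃[ v ] (edge N i ≡ undir u v)))
     → Σ (SDGraph n m) (λ R → IsRootedPartner R N × edge C i ≡ edge R i))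
  × (¬ (InEDP N i × (∃[ u ] ∃[ v ] (edge N i ≡ undir u v))) → edge C i ≡ edge N i)

-- Rooted partners agree on E_DP(N). Suppose R orients an undirected edge ab of N
-- as b → a and R′ as a → b; then a lies in a root class. Indeed, given w reaching
-- a, take a non-backtracking path from w to a, drop its last edge if that is ab
-- (switching to R′ and the vertex b), and walk it backwards. If the current vertex
-- z has an N-undirected edge e oriented into z by the current partner, the path's
-- previous edge f ≠ e cannot also enter z there (z would be hybrid, making e a
-- hybrid edge, hence directed in N), so f leaves z: it is undirected in N, can be
-- traversed back, and is oriented into the previous vertex. This yields a path
-- from a to w. Consequently C agrees edgewise with N or with one fixed rooted
-- partner R₀, so C lies between N and R₀ in the compatibility order. Directing
-- edges creates no semidirected cycle and only increases in-degrees, so C is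
-- acyclic and its hybrid edges are squeezed between those of N and R₀.
module Submission where

open import Defs
open import Data.Nat using (ℕ; _≤_; s≤s)
open import Data.Nat.Properties using (m≤n⇒m≤1+n; ≤-trans)
open import Data.Fin using (Fin; _≟_)
open import Data.List using (List; length; filterᵇ; allFin)
open import Data.List.Relation.Unary.Any using (here; there)
open import Data.List.Membership.Propositional using (_∈_)
open import Data.List.Membership.Propositional.Properties using (∈-allFin; ∈-filter⁺; ∈-length)
open import Data.List.Relation.Binary.Sublist.Propositional using (⊆-refl)
open import Data.List.Relation.Binary.Sublist.Propositional.Properties using (filter⁺)
open import Data.List.Relation.Binary.Sublist.Heterogeneous.Properties using (length-mono-≤)
open import Data.Bool using (T)
open import Data.Product using (Σ; ∃-syntax; _×_; _,_; proj₁; proj₂)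
open import Data.Sum using (_⊎_; inj₁; inj₂)
open import Data.Unit using (⊤; tt)
open import Data.Empty using (⊥-elim)
open import Function using (_∘_)
open import Function.Bundles using (_⇔_; mk⇔; Equivalence)
open import Relation.Nullary using (¬_; yes; no)
open import Relation.Nullary.Decidable using (T?; decidable-stable)
open import Relation.Binary.Definitions using (DecidableEquality)
open import Relation.Binary.PropositionalEquality

distinct-∈⇒2≤length : ∀ {A : Set} {xs : List A} {x y} → x ∈ xs → y ∈ xs → x ≢ y → 2 ≤ length xs
distinct-∈⇒2≤length (here refl) (here refl) x≢y = ⊥-elim (x≢y refl)
distinct-∈⇒2≤length (here _)    (there y∈)  _   = s≤s (∈-length y∈)
distinct-∈⇒2≤length (there x∈)  (here _)    _   = s≤s (∈-length x∈)
distinct-∈⇒2≤length (there x∈)  (there y∈)  x≢y = m≤n⇒m≤1+n (distinct-∈⇒2≤length x∈ y∈ x≢y)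

module _ {n : ℕ} where

  Directed Undirected : Edge n → Set
  Directed   e = ∃[ u ] ∃[ v ] (e ≡ dir u v)
  Undirected e = ∃[ u ] ∃[ v ] (e ≡ undir u v)

  EdgeLink : Edge n → Fin n → Fin n → Set
  EdgeLink e u w = (e ≡ undir u w) ⊎ (e ≡ undir w u) ⊎ (e ≡ dir u w)

  directed-or-undirected : ∀ e → Directed e ⊎ Undirected e
  directed-or-undirected (dir u v)   = inj₁ (u , v , refl)
  directed-or-undirected (undir u v) = inj₂ (u , v , refl)

  _≟ᴱ_ : DecidableEquality (Edge n)
  undir a b ≟ᴱ undir c d with a ≟ c | b ≟ d
  ... | yes refl | yes refl = yes refl
  ... | no a≢c   | _        = no λ { refl → a≢c refl }
  ... | yes _    | no b≢d   = no λ { refl → b≢d refl }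
  undir _ _ ≟ᴱ dir _ _ = no λ ()
  dir _ _ ≟ᴱ undir _ _ = no λ ()
  dir a b ≟ᴱ dir c d with a ≟ c | b ≟ d
  ... | yes refl | yes refl = yes refl
  ... | no a≢c   | _        = no λ { refl → a≢c refl }
  ... | yes _    | no b≢d   = no λ { refl → b≢d refl }

  EdgeLink-reverse : ∀ {e : Edge n} {u w} → Undirected e → EdgeLink e u w → EdgeLink e w u
  EdgeLink-reverse (_ , _ , refl) (inj₁ e≡uw)        = inj₂ (inj₁ e≡uw)
  EdgeLink-reverse (_ , _ , refl) (inj₂ (inj₁ e≡wu)) = inj₁ e≡wu

  EdgeLink-backtrack : ∀ {e : Edge n} {u v w} → NoLoop e → EdgeLink e u v → EdgeLink e v w → u ≡ w
  EdgeLink-backtrack u≢u (inj₁ refl)        (inj₁ refl)        = ⊥-elim (u≢u refl)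
  EdgeLink-backtrack _   (inj₁ refl)        (inj₂ (inj₁ refl)) = refl
  EdgeLink-backtrack _   (inj₂ (inj₁ refl)) (inj₁ refl)        = refl
  EdgeLink-backtrack u≢u (inj₂ (inj₁ refl)) (inj₂ (inj₁ refl)) = ⊥-elim (u≢u refl)
  EdgeLink-backtrack u≢u (inj₂ (inj₂ refl)) (inj₂ (inj₂ refl)) = ⊥-elim (u≢u refl)

  EdgeCompatible-link : ∀ {e′ e : Edge n} {u w} → EdgeCompatible e′ e → EdgeLink e′ u w → EdgeLink e u w
  EdgeCompatible-link (inj₁ refl)                        link               = link
  EdgeCompatible-link (inj₂ (_ , _ , refl , inj₁ refl)) (inj₂ (inj₂ refl)) = inj₁ refl
  EdgeCompatible-link (inj₂ (_ , _ , refl , inj₂ refl)) (inj₂ (inj₂ refl)) = inj₂ (inj₁ refl)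

  EdgeCompatible-dir : ∀ {e′ e : Edge n} {u v} → EdgeCompatible e′ e → e ≡ dir u v → e′ ≡ e
  EdgeCompatible-dir (inj₁ e′≡e)               _  = e′≡e
  EdgeCompatible-dir (inj₂ (_ , _ , refl , _)) ()

  EdgeCompatible-undir : ∀ {e′ e : Edge n} {a b} → EdgeCompatible e′ e → Directed e′ → e ≡ undir a b →
                         (e′ ≡ dir a b) ⊎ (e′ ≡ dir b a)
  EdgeCompatible-undir (inj₁ refl)                   (_ , _ , refl) ()
  EdgeCompatible-undir (inj₂ (_ , _ , refl , e′≡ab)) _              refl = e′≡ab

  EdgeCompatible-traversed : ∀ {e′ e : Edge n} {u w} → EdgeCompatible e′ e → Directed e′ → EdgeLink e u w →
                             (e′ ≡ dir u w) ⊎ (e′ ≡ dir w u × Undirected e)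
  EdgeCompatible-traversed (inj₁ refl) (_ , _ , refl) (inj₂ (inj₂ refl)) = inj₁ refl
  EdgeCompatible-traversed (inj₂ (_ , _ , refl , inj₁ refl)) _ (inj₁ refl)        = inj₁ refl
  EdgeCompatible-traversed (inj₂ (_ , _ , refl , inj₁ refl)) _ (inj₂ (inj₁ refl)) = inj₂ (refl , _ , _ , refl)
  EdgeCompatible-traversed (inj₂ (_ , _ , refl , inj₂ refl)) _ (inj₁ refl)        = inj₂ (refl , _ , _ , refl)
  EdgeCompatible-traversed (inj₂ (_ , _ , refl , inj₂ refl)) _ (inj₂ (inj₁ refl)) = inj₁ refl

  intoᵇ-child : ∀ (u v : Fin n) → T (intoᵇ (dir u v) v)
  intoᵇ-child u v with v ≟ v
  ... | yes _   = tt
  ... | no v≢v = ⊥-elim (v≢v refl)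

  EdgeCompatible-intoᵇ : ∀ {e′ e : Edge n} {v} → EdgeCompatible e′ e → T (intoᵇ e v) → T (intoᵇ e′ v)
  EdgeCompatible-intoᵇ (inj₁ refl)               into = into
  EdgeCompatible-intoᵇ (inj₂ (_ , _ , refl , _)) ()

module _ {n m : ℕ} where

  two-parents⇒hybrid : ∀ (N : SDGraph n m) {e f x y z} → edge N e ≡ dir x z → edge N f ≡ dir y z → e ≢ f →
                       IsHybrid N z
  two-parents⇒hybrid N {e} {f} {z = z} Ne Nf e≢f =
    distinct-∈⇒2≤length (parent-counted Ne) (parent-counted Nf) e≢f
    where
    parent-counted : ∀ {i u} → edge N i ≡ dir u z → i ∈ filterᵇ (λ j → intoᵇ (edge N j) z) (allFin m)
    parent-counted {i} {u} Ni =
      ∈-filter⁺ (λ j → T? (intoᵇ (edge N j) z)) (∈-allFin i) (subst (λ d → T (intoᵇ d z)) (sym Ni) (intoᵇ-child u z))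

  Compatible⇒indeg-≤ : ∀ {N′ N : SDGraph n m} → Compatible N′ N → ∀ v → indeg N v ≤ indeg N′ v
  Compatible⇒indeg-≤ {N′} {N} compat v =
    length-mono-≤ (filter⁺ (λ i → T? (intoᵇ (edge N i) v)) (λ i → T? (intoᵇ (edge N′ i) v))
                           (λ { {i} refl → EdgeCompatible-intoᵇ (compat i) }) (⊆-refl {x = allFin m}))

  Compatible⇒hybridEdge : ∀ {N′ N : SDGraph n m} → Compatible N′ N → ∀ {i} → IsHybridEdge N i → IsHybridEdge N′ i
  Compatible⇒hybridEdge {N′} {N} compat {i} (u , v , Ni , hybrid) =
    u , v , trans (EdgeCompatible-dir (compat i) Ni) Ni , ≤-trans hybrid (Compatible⇒indeg-≤ {N′} {N} compat v)

  Compatible⇒Acyclic : ∀ {N′ N : SDGraph n m} → Compatible N′ N → Acyclic N → Acyclic N′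
  Compatible⇒Acyclic compat acyclic cycle =
    acyclic record { SDCycle cycle ; links = λ j → EdgeCompatible-link (compat _) (links j) }
    where open SDCycle cycle using (links)

  PhyloCompatible-interpolate : ∀ {N C R : SDGraph n m} → Compatible C N → Compatible R C →
                                PhyloCompatible R N → PhyloCompatible R C × PhyloCompatible C N
  PhyloCompatible-interpolate {N} {C} {R} compatCN compatRC (acyclicR , acyclicN , _ , hybridRN) =
    (acyclicR , acyclicC , compatRC , hybridRC) , (acyclicC , acyclicN , compatCN , hybridCN)
    where
    acyclicC : Acyclic C
    acyclicC = Compatible⇒Acyclic {C} {N} compatCN acyclicN
    C⊇N : ∀ {i} → IsHybridEdge N i → IsHybridEdge C i
    C⊇N = Compatible⇒hybridEdge {C} {N} compatCN
    R⊇C : ∀ {i} → IsHybridEdge C i → IsHybridEdge R i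
    R⊇C = Compatible⇒hybridEdge {R} {C} compatRC
    hybridRC : ∀ i → IsHybridEdge R i ⇔ IsHybridEdge C i
    hybridRC i = mk⇔ (C⊇N ∘ Equivalence.to (hybridRN i)) R⊇C
    hybridCN : ∀ i → IsHybridEdge C i ⇔ IsHybridEdge N i
    hybridCN i = mk⇔ (Equivalence.to (hybridRN i) ∘ R⊇C) C⊇N

module _ {n m : ℕ} (N : SDGraph n m) where

  data SnocPath : Fin n → Fin n → Set where
    []   : ∀ {u} → SnocPath u u
    snoc : ∀ {u v w} → SnocPath u v → (i : Fin m) → Link N i v w → SnocPath u w

  LastEdge≢ : ∀ {u v} → Fin m → SnocPath u v → Set
  LastEdge≢ e []           = ⊤
  LastEdge≢ e (snoc _ f _) = f ≢ e

  NonBacktracking : ∀ {u v} → SnocPath u v → Set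
  NonBacktracking []           = ⊤
  NonBacktracking (snoc P f _) = LastEdge≢ f P × NonBacktracking P

  snoc-nonBacktracking : ∀ {u v w} (P : SnocPath u v) → NonBacktracking P → (f : Fin m) → Link N f v w →
                         Σ (SnocPath u w) NonBacktracking
  snoc-nonBacktracking [] _ f link = snoc [] f link , tt , tt
  snoc-nonBacktracking (snoc P g link′) nb f link with g ≟ f
  ... | no g≢f = snoc (snoc P g link′) f link , g≢f , nb
  ... | yes refl with EdgeLink-backtrack (noLoop N f) link′ link
  ...   | refl = P , proj₂ nb

  nonBacktracking : ∀ {u v} → SDPath N u v → Σ (SnocPath u v) NonBacktracking
  nonBacktracking = extend ([] , tt)
    where
    extend : ∀ {u v w} → Σ (SnocPath u v) NonBacktracking → SDPath N v w → Σ (SnocPath u w) NonBacktracking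
    extend P here                       = P
    extend (P , nb) (step f link rest) = extend (snoc-nonBacktracking P nb f link) rest

module RootedPartner {n m : ℕ} {N R : SDGraph n m} (partner : IsRootedPartner R N) where

  directed : AllDirected R
  directed = proj₁ (proj₁ partner)

  compatible : Compatible R N
  compatible = proj₁ (proj₂ (proj₂ (proj₂ partner)))

  sameHybridEdges : ∀ i → IsHybridEdge R i ⇔ IsHybridEdge N i
  sameHybridEdges = proj₂ (proj₂ (proj₂ (proj₂ partner)))

  undirected-child-¬hybrid : ∀ {e x z} → Undirected (edge N e) → edge R e ≡ dir x z → ¬ IsHybrid R z
  undirected-child-¬hybrid {e} (_ , _ , Ne) Re hybrid
    with Equivalence.to (sameHybridEdges e) (_ , _ , Re , hybrid)
  ... | _ , _ , Ne′ , _ with trans (sym Ne) Ne′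
  ...   | ()

  parentEdge-unique : ∀ {e f x y z} → Undirected (edge N e) → edge R e ≡ dir x z → edge R f ≡ dir y z → f ≡ e
  parentEdge-unique {e} {f} undirected Re Rf = decidable-stable (f ≟ e) λ f≢e →
    undirected-child-¬hybrid undirected Re (two-parents⇒hybrid R Rf Re f≢e)

  retrace : ∀ {w z e x} (P : SnocPath N w z) → NonBacktracking N P → LastEdge≢ N e P →
            Undirected (edge N e) → edge R e ≡ dir x z → SDPath N z w
  retrace [] _ _ _ _ = here
  retrace (snoc P f link) (lastEdge≢f , nb) f≢e undirected Re
    with EdgeCompatible-traversed (compatible f) (directed f) link
  ... | inj₁ Rf = ⊥-elim (f≢e (parentEdge-unique undirected Re Rf))
  ... | inj₂ (Rf , undirectedf) =
    step f (EdgeLink-reverse undirectedf link) (retrace P nb lastEdge≢f undirectedf Rf)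

  keeps-directed : ∀ {i u v} → edge N i ≡ dir u v → edge R i ≡ edge N i
  keeps-directed {i} = EdgeCompatible-dir (compatible i)

  orients : ∀ {i a b} → edge N i ≡ undir a b → (edge R i ≡ dir a b) ⊎ (edge R i ≡ dir b a)
  orients {i} = EdgeCompatible-undir (compatible i) (directed i)

module _ {n m : ℕ} {N : SDGraph n m} where

  undirected-InRootComponent : ∀ {i a b} → edge N i ≡ undir a b → InRootClass N a → InRootComponent N i
  undirected-InRootComponent {i} {a} {b} Ni root =
    a , b , subst (λ e → Endpoints e a b) (sym Ni) (refl , refl) ,
    (step i (inj₂ (inj₁ Ni)) here , step i (inj₁ Ni) here) , root

  opposite-orientations⇒InRootClass : ∀ {R R′ : SDGraph n m} → IsRootedPartner R N → IsRootedPartner R′ N →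
    ∀ {i a b} → edge N i ≡ undir a b → edge R i ≡ dir b a → edge R′ i ≡ dir a b → InRootClass N a
  opposite-orientations⇒InRootClass partner partner′ {i} Ni Ri R′i w w⇝a with nonBacktracking N w⇝a
  ... | [] , _ = here
  ... | snoc P f link , nb with f ≟ i
  ...   | no f≢i = RootedPartner.retrace partner (snoc P f link) nb f≢i (_ , _ , Ni) Ri
  ...   | yes refl with EdgeLink-backtrack (noLoop N i) link (inj₁ Ni)
  ...     | refl = step i (inj₁ Ni) (RootedPartner.retrace partner′ P (proj₂ nb) (proj₁ nb) (_ , _ , Ni) R′i)

  rootedPartners-agree-on-EDP : ∀ {R R′ : SDGraph n m} → IsRootedPartner R N → IsRootedPartner R′ N →
                                ∀ {i} → InEDP N i → edge R i ≡ edge R′ i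
  rootedPartners-agree-on-EDP partner partner′ {i} edp with directed-or-undirected (edge N i)
  ... | inj₁ (_ , _ , Ni) =
    trans (RootedPartner.keeps-directed partner Ni) (sym (RootedPartner.keeps-directed partner′ Ni))
  ... | inj₂ (_ , _ , Ni) with RootedPartner.orients partner Ni | RootedPartner.orients partner′ Ni
  ...   | inj₁ Ri | inj₁ R′i = trans Ri (sym R′i)
  ...   | inj₂ Ri | inj₂ R′i = trans Ri (sym R′i)
  ...   | inj₂ Ri | inj₁ R′i =
    ⊥-elim (edp (undirected-InRootComponent Ni (opposite-orientations⇒InRootClass partner partner′ Ni Ri R′i)))
  ...   | inj₁ Ri | inj₂ R′i =
    ⊥-elim (edp (undirected-InRootComponent Ni (opposite-orientations⇒InRootClass partner′ partner Ni R′i Ri)))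

module Completion {n m : ℕ} {N C R₀ : SDGraph n m} (partner₀ : IsRootedPartner R₀ N) (completion : IsCompletion N C) where

  edge-as-partner-or-unchanged : ∀ i → (edge C i ≡ edge R₀ i) ⊎ (edge C i ≡ edge N i)
  edge-as-partner-or-unchanged i with edge C i ≟ᴱ edge R₀ i
  ... | yes C≡R₀ = inj₁ C≡R₀
  ... | no C≢R₀  = inj₂ (proj₂ (completion i) (C≢R₀ ∘ agrees-with-R₀))
    where
    agrees-with-R₀ : InEDP N i × Undirected (edge N i) → edge C i ≡ edge R₀ i
    agrees-with-R₀ edp×undirected with proj₁ (completion i) edp×undirected
    ... | _ , partner , C≡R = trans C≡R (rootedPartners-agree-on-EDP partner partner₀ (proj₁ edp×undirected))

  compatible-C-N : Compatible C N
  compatible-C-N i with edge-as-partner-or-unchanged i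
  ... | inj₁ C≡R₀ = subst (λ e → EdgeCompatible e (edge N i)) (sym C≡R₀) (RootedPartner.compatible partner₀ i)
  ... | inj₂ C≡N  = inj₁ C≡N

  compatible-R₀-C : Compatible R₀ C
  compatible-R₀-C i with edge-as-partner-or-unchanged i
  ... | inj₁ C≡R₀ = inj₁ (sym C≡R₀)
  ... | inj₂ C≡N  = subst (EdgeCompatible (edge R₀ i)) (sym C≡N) (RootedPartner.compatible partner₀ i)

proposition8 : ∀ {n m} (N C : SDGraph n m) → IsNetwork N → IsCompletion N C →
    IsNetwork C × PhyloCompatible C N
proposition8 N C (_ , R₀ , dag₀ , phylo₀) completion =
  let R₀≈C , C≈N = PhyloCompatible-interpolate compatible-C-N compatible-R₀-C phylo₀
  in (proj₁ C≈N , R₀ , dag₀ , R₀≈C) , C≈N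
  where open Completion {N = N} {C} {R₀} (dag₀ , phylo₀) completion
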